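{- For all packed words $u,v,w$ with $w\ne\varepsilon$, $u\triangleleft_B(v\triangleleft_B w)=(v\odot u)\triangleleft_B w$.
   Context: Words over positive integers; $\max(w)$ largest letter ($\max(\varepsilon)=0$), $w^{[k]}$ adds $k$ to every letter. Packed: every integer $1..\max(w)$ occurs. $u\odot v=u^{[\max(v)]}\cdot v$. For packed $w$: $\psi_{i^\circ}(w)$ ($1\le i\le\max(w)+1$) adds $1$ to every letter $\ge i$ and appends the letter $i$; $\psi_{i^\bullet}(w)=w\cdot i$ ($1\le i\le\max(w)$). Each nonempty packed $v$ is uniquely $\psi_{i^\alpha}(v')$ with $v'$ packed and $\alpha\in\{\circ,\bullet\}$. For packed $u$ and nonempty packed $v=\psi_{i^\alpha}(v')$, $u\triangleleft_B v=\psi_{(i+\max(u))^\alpha}(v'\odot u)$. -}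

module Defs where

open import Data.Nat using (ℕ; zero; suc; _+_; _∸_; _≤_; _<_; _⊔_; _≤ᵇ_; _≡ᵇ_)
open import Data.Bool using (Bool; true; false; if_then_else_)
open import Data.List using (List; []; _∷_; _++_; map; foldr; reverse; _∷ʳ_)
open import Data.Bool.ListAction using (any)
open import Data.List.Membership.Propositional using (_∈_)
open import Data.List.Relation.Unary.All using (All)
open import Data.Product using (_×_)

-- Words over positive integers are lists of naturals; positivity is part of
-- the predicate `Packed` below.
Word : Set
Word = List ℕ

ε : Word
ε = []

maxW : Word → ℕ
maxW = foldr _⊔_ 0

shift : ℕ → Word → Word
shift k = map (k +_)

Packed : Word → Set
Packed w = All (λ a → 1 ≤ a) w × (∀ j → 1 ≤ j → j ≤ maxW w → j ∈ w)

_⊙_ : Word → Word → Word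
u ⊙ v = shift (maxW v) u ++ v

data Kind : Set where
  ∘ : Kind
  • : Kind

ψ : ℕ → Kind → Word → Word
ψ i ∘ w = map (λ a → if i ≤ᵇ a then suc a else a) w ∷ʳ i
ψ i • w = w ∷ʳ i

unbump : ℕ → Word → Word
unbump i = map (λ a → if suc i ≤ᵇ a then a ∸ 1 else a)

-- The unique decomposition of a nonempty packed word v = w · i as ψ_{i^α}(v'):
-- if the last letter i occurs in w, then α = • and v' = w; otherwise α = ∘ and
-- v' is w with every letter > i decreased by 1.  Given as (i , α , v')
-- computed from the reversed word (last letter first).
record Decomp : Set where
  constructor dec
  field
    letter : ℕ
    kind   : Kind
    rest   : Word

decompRev : ℕ → List ℕ → Decomp
decompRev i rw =
  let w = reverse rw in
  if any (λ a → a ≡ᵇ i) w then dec i • w else dec i ∘ (unbump i w)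

-- u ◁_B v  (for v = ε we return u ⊙ ε arbitrarily; the theorem only uses
-- nonempty right arguments, as in the paper)
_◁B_ : Word → Word → Word
u ◁B v with reverse v
... | []      = u
... | i ∷ rw  with decompRev i rw
...   | dec j α v' = ψ (j + maxW u) α (v' ⊙ u)

{-# OPTIONS --safe #-}
module Submission where

-- u ◁B v only looks at the last step v = ψ_{k^α}(Y) of v and rebuilds it as
-- ψ_{(k + max u)^α}(Y ⊙ u).  Decomposing such a word recovers exactly this
-- step (for α = • because k, hence k + max u, already occurs in the prefix),
-- so u ◁B (v ◁B w) grafts v and then u onto the prefix of w.  Since ⊙ is
-- associative and max (v ⊙ u) = max u + max v, this is grafting v ⊙ u.

open import Defs
open import Relation.Binary.PropositionalEquality
open import Relation.Nullary using (contradiction)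
open import Relation.Nullary.Reflects using (ofʸ; ofⁿ)
open import Relation.Nullary.Decidable using (dec-true; dec-false)
open import Function using (_∘′_; Equivalence)
open import Data.Empty using (⊥-elim)
open import Data.Bool using (true; false; if_then_else_)
open import Data.Bool.Properties using (T-≡)
open import Data.Bool.ListAction using (any)
open import Data.Nat using (ℕ; suc; _+_; _⊔_; _∸_; _≤_; _≤ᵇ_; _≡ᵇ_; s≤s)
open import Data.Nat.Properties
open import Data.List using ([]; _∷_; _++_; _∷ʳ_; map; foldr; reverse)
open import Data.List.Properties
  using (map-++; ++-assoc; foldr-++; reverse-++; reverse-involutive; reverse-injective)
open import Data.List.Relation.Unary.Any as Any using (Any)
open import Data.List.Relation.Unary.Any.Properties using (any⁺; any⁻)
open import Data.List.Membership.Propositional using (_∈_; _∉_)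
open import Data.List.Membership.Propositional.Properties using (∈-map⁺; ∈-map⁻; ∈-++⁺ˡ)
open import Data.Product using (_,_; ∃₂)

any≡ᵇ⇒∈ : ∀ {k} Y → any (_≡ᵇ k) Y ≡ true → k ∈ Y
any≡ᵇ⇒∈ Y h = Any.map (λ t → sym (≡ᵇ⇒≡ _ _ t)) (any⁻ _ Y (Equivalence.from T-≡ h))

∈⇒any≡ᵇ : ∀ {k Y} → k ∈ Y → any (_≡ᵇ k) Y ≡ true
∈⇒any≡ᵇ k∈Y = Equivalence.to T-≡ (any⁺ _ (Any.map (λ k≡y → ≡⇒≡ᵇ _ _ (sym k≡y)) k∈Y))

∉⇒any≡ᵇ : ∀ {k} Y → k ∉ Y → any (_≡ᵇ k) Y ≡ false
∉⇒any≡ᵇ {k} Y k∉Y with any (_≡ᵇ k) Y in h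
... | true  = contradiction (any≡ᵇ⇒∈ Y h) k∉Y
... | false = refl

bump : ℕ → ℕ → ℕ
bump k a = if k ≤ᵇ a then suc a else a

bump-≢ : ∀ k a → bump k a ≢ k
bump-≢ k a with k ≤ᵇ a | ≤ᵇ-reflects-≤ k a
... | true  | ofʸ k≤a = λ 1+a≡k → 1+n≰n (subst (_≤ a) (sym 1+a≡k) k≤a)
... | false | ofⁿ k≰a = λ a≡k → k≰a (≤-reflexive (sym a≡k))

∉-map-bump : ∀ k Y → k ∉ map (bump k) Y
∉-map-bump k Y k∈ with ∈-map⁻ (bump k) k∈
... | a , _ , k≡bump = bump-≢ k a (sym k≡bump)

unbump-bump : ∀ k Y → unbump k (map (bump k) Y) ≡ Y
unbump-bump k []      = refl
unbump-bump k (a ∷ Y) = cong₂ _∷_ letter (unbump-bump k Y)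
  where
  letter : (if suc k ≤ᵇ bump k a then bump k a ∸ 1 else bump k a) ≡ a
  letter with k ≤ᵇ a | ≤ᵇ-reflects-≤ k a
  ... | true  | ofʸ k≤a rewrite dec-true (suc k ≤? suc a) (s≤s k≤a) = refl
  ... | false | ofⁿ k≰a rewrite dec-false (suc k ≤? a) (λ 1+k≤a → k≰a (≤-trans (n≤1+n k) 1+k≤a)) = refl

foldr⊔-shift : ∀ m xs → foldr _⊔_ m (shift m xs) ≡ m + maxW xs
foldr⊔-shift m []       = sym (+-identityʳ m)
foldr⊔-shift m (x ∷ xs) = begin
  (m + x) ⊔ foldr _⊔_ m (shift m xs) ≡⟨ cong ((m + x) ⊔_) (foldr⊔-shift m xs) ⟩
  (m + x) ⊔ (m + maxW xs)            ≡⟨ +-distribˡ-⊔ m x (maxW xs) ⟨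
  m + (x ⊔ maxW xs)                  ∎
  where open ≡-Reasoning

maxW-⊙ : ∀ v u → maxW (v ⊙ u) ≡ maxW u + maxW v
maxW-⊙ v u = trans (foldr-++ _⊔_ 0 (shift (maxW u) v) u) (foldr⊔-shift (maxW u) v)

shift-shift : ∀ a b xs → shift a (shift b xs) ≡ shift (a + b) xs
shift-shift a b []       = refl
shift-shift a b (x ∷ xs) = cong₂ _∷_ (sym (+-assoc a b x)) (shift-shift a b xs)

⊙-assoc : ∀ w v u → (w ⊙ v) ⊙ u ≡ w ⊙ (v ⊙ u)
⊙-assoc w v u = begin
  shift (maxW u) (shift (maxW v) w ++ v) ++ u
    ≡⟨ cong (_++ u) (map-++ (maxW u +_) (shift (maxW v) w) v) ⟩
  (shift (maxW u) (shift (maxW v) w) ++ shift (maxW u) v) ++ u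
    ≡⟨ cong (λ x → (x ++ shift (maxW u) v) ++ u) (shift-shift (maxW u) (maxW v) w) ⟩
  (shift (maxW u + maxW v) w ++ shift (maxW u) v) ++ u
    ≡⟨ ++-assoc (shift (maxW u + maxW v) w) (shift (maxW u) v) u ⟩
  shift (maxW u + maxW v) w ++ (v ⊙ u)
    ≡⟨ cong (λ m → shift m w ++ (v ⊙ u)) (maxW-⊙ v u) ⟨
  w ⊙ (v ⊙ u) ∎
  where open ≡-Reasoning

build : Decomp → Word
build d = ψ (Decomp.letter d) (Decomp.kind d) (Decomp.rest d)

graft : Word → Decomp → Decomp
graft u d = dec (Decomp.letter d + maxW u) (Decomp.kind d) (Decomp.rest d ⊙ u)

graft-graft : ∀ u v d → graft u (graft v d) ≡ graft (v ⊙ u) d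
graft-graft u v (dec k α Y) = cong₂ (λ j r → dec j α r) letter (⊙-assoc Y v u)
  where
  letter : k + maxW v + maxW u ≡ k + maxW (v ⊙ u)
  letter = trans (+-assoc k (maxW v) (maxW u))
                 (cong (k +_) (trans (+-comm (maxW v) (maxW u)) (sym (maxW-⊙ v u))))

-- The decompositions actually produced by decompRev: a •-step reuses a letter.
data Valid : Decomp → Set where
  valid∘ : ∀ k Y → Valid (dec k ∘ Y)
  valid• : ∀ k Y → k ∈ Y → Valid (dec k • Y)

decompRev-valid : ∀ i rw → Valid (decompRev i rw)
decompRev-valid i rw with any (_≡ᵇ i) (reverse rw) in h
... | true  = valid• i (reverse rw) (any≡ᵇ⇒∈ (reverse rw) h)
... | false = valid∘ i (unbump i (reverse rw))

graft-valid : ∀ u {d} → Valid d → Valid (graft u d)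
graft-valid u (valid∘ k Y)     = valid∘ (k + maxW u) (Y ⊙ u)
graft-valid u (valid• k Y k∈Y) = valid• (k + maxW u) (Y ⊙ u)
  (∈-++⁺ˡ (subst (_∈ shift (maxW u) Y) (+-comm (maxW u) k) (∈-map⁺ (maxW u +_) k∈Y)))

◁B-reverse : ∀ u w {i rw} → reverse w ≡ i ∷ rw → u ◁B w ≡ build (graft u (decompRev i rw))
◁B-reverse u w eq with reverse w | eq
... | _ | refl = refl

◁B-snoc : ∀ u k Y → u ◁B (Y ∷ʳ k) ≡ build (graft u (decompRev k (reverse Y)))
◁B-snoc u k Y = ◁B-reverse u (Y ∷ʳ k) (reverse-++ Y (k ∷ []))

decompRev-ψ∘ : ∀ k Y → decompRev k (reverse (map (bump k) Y)) ≡ dec k ∘ Y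
decompRev-ψ∘ k Y
  rewrite reverse-involutive (map (bump k) Y)
        | ∉⇒any≡ᵇ (map (bump k) Y) (∉-map-bump k Y)
        | unbump-bump k Y = refl

decompRev-ψ• : ∀ {k Y} → k ∈ Y → decompRev k (reverse Y) ≡ dec k • Y
decompRev-ψ• {Y = Y} k∈Y rewrite reverse-involutive Y | ∈⇒any≡ᵇ k∈Y = refl

◁B-build : ∀ u {d} → Valid d → u ◁B build d ≡ build (graft u d)
◁B-build u (valid∘ k Y) =
  trans (◁B-snoc u k (map (bump k) Y)) (cong (build ∘′ graft u) (decompRev-ψ∘ k Y))
◁B-build u (valid• k Y k∈Y) =
  trans (◁B-snoc u k Y) (cong (build ∘′ graft u) (decompRev-ψ• k∈Y))

reverse-≢ε : ∀ {w} → w ≢ ε → ∃₂ λ i rw → reverse w ≡ i ∷ rw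
reverse-≢ε {w} w≢ε with reverse w in rev-w
... | []     = ⊥-elim (w≢ε (reverse-injective rev-w))
... | i ∷ rw = i , rw , refl

mainTheorem17 : (u v w : Word) → Packed u → Packed v → Packed w → w ≢ ε →
    u ◁B (v ◁B w) ≡ (v ⊙ u) ◁B w
mainTheorem17 u v w _ _ _ w≢ε with reverse-≢ε w≢ε
... | i , rw , rev-w = begin
  u ◁B (v ◁B w)               ≡⟨ cong (u ◁B_) (◁B-reverse v w rev-w) ⟩
  u ◁B build (graft v d)      ≡⟨ ◁B-build u (graft-valid v (decompRev-valid i rw)) ⟩
  build (graft u (graft v d)) ≡⟨ cong build (graft-graft u v d) ⟩
  build (graft (v ⊙ u) d)     ≡⟨ ◁B-reverse (v ⊙ u) w rev-w ⟨
  (v ⊙ u) ◁B w                ∎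
  where
  open ≡-Reasoning
  d : Decomp
  d = decompRev i rw
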